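{- Let $c$ be a horizontal configuration and let $c'$ be a subconfiguration of $c$. Then for every derivation $\sigma$ of $c$ there exists a derivation $\sigma'$ of $c'$ such that $\sigma$ contains $\sigma'$.
   Context: A Cayley permutation is a word over the positive integers in which every integer between $1$ and its maximum occurs; standardisation replaces the smallest value by $1$, the next smallest by $2$, etc.; $\sigma$ contains $\sigma'$ if some subsequence of $\sigma$ standardises to $\sigma'$. Horizontal evolution: a Cayley permutation $\pi=\pi_1\cdots\pi_n$ is built by adding its entries from left to right. After the first $t$ entries have been placed, the configuration consists of the prefix (the standardisation of $\pi_1\cdots\pi_t$) together with slots placed at relative heights: a repeating slot $\overline{\diamond}$ at the height of each prefix value that occurs again among $\pi_{t+1},\dots,\pi_n$, and a new slot $\diamond$ in each gap between consecutive distinct prefix values (or below the minimum, or above the maximum) that contains some value of $\pi_{t+1}\cdots\pi_n$ not occurring in the prefix. The evolution starts with the single slot $\diamond$. A horizontal configuration is any configuration occurring in the horizontal evolution of some Cayley permutation, and the derivations of a configuration $c$ are the Cayley permutations whose horizontal evolution contains $c$. A subconfiguration of $c$ is a horizontal configuration $c'$ obtained from $c$ by deleting some entries of the prefix of $c$ (and standardising), keeping the same slots with the same relative heights, where a repeating slot becomes a new slot if all prefix entries of its value are deleted. -}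

module Defs where

open import Data.Bool using (Bool; true; false; _∧_; _∨_; not)
open import Data.Nat using (ℕ; zero; suc; _≤_; _⊔_; _∸_; _≡ᵇ_)
open import Data.List using (List; []; _∷_; map; filter; length; foldr; take; drop; applyUpTo; upTo)
open import Data.Bool.ListAction using (any)
open import Relation.Nullary.Decidable using (T?)
open import Data.Bool using (T)
open import Data.List.Membership.Propositional using (_∈_)
open import Data.List.Relation.Unary.All using (All)
open import Data.List.Relation.Binary.Sublist.Propositional using (_⊆_)
open import Data.Product using (Σ; ∃; _×_)
open import Relation.Binary.PropositionalEquality using (_≡_)

elem : ℕ → List ℕ → Bool
elem x = any (x ≡ᵇ_)

maxL : List ℕ → ℕ
maxL = foldr _⊔_ 0

range1 : ℕ → List ℕ
range1 m = applyUpTo suc m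

range0 : ℕ → List ℕ
range0 m = upTo (suc m)

cntBelow : List ℕ → ℕ → ℕ
cntBelow u x = length (filter (λ v → T? (elem v u)) (upTo x))

rank : List ℕ → ℕ → ℕ
rank u x = suc (cntBelow u x)

std : List ℕ → List ℕ
std u = map (rank u) u

IsCayley : List ℕ → Set
IsCayley w = All (λ x → 1 ≤ x) w × (∀ k → 1 ≤ k → k ≤ maxL w → k ∈ w)

Contains : List ℕ → List ℕ → Set
Contains σ σ' = Σ (List ℕ) (λ τ → (τ ⊆ σ) × (std τ ≡ σ'))

at : List Bool → ℕ → Bool
at []       _       = false
at (b ∷ bs) zero    = b
at (b ∷ bs) (suc n) = at bs n

-- A configuration: standardised prefix `pre` with maximum m,
-- `rep` : list of length m, entry j-1 says whether there is a repeating slot at height j,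
-- `new` : list of length m+1, entry g says whether there is a new slot in gap g
--         (gap g lies between prefix values g and g+1; gap 0 below the minimum,
--          gap m above the maximum).
record Config : Set where
  constructor config
  field
    pre : List ℕ
    rep : List Bool
    new : List Bool
open Config public

-- The configuration of the horizontal evolution of π after its first t entries.
conf : List ℕ → ℕ → Config
conf π t = config (std u) repL newL
  where
  u = take t π
  r = drop t π
  m = maxL (std u)
  repL = map (λ j → any (λ x → (rank u x ≡ᵇ j) ∧ elem x r) u) (range1 m)
  newL = map (λ g → any (λ y → not (elem y u) ∧ (cntBelow u y ≡ᵇ g)) r) (range0 m)

Derivation : Config → List ℕ → Set
Derivation c σ = IsCayley σ × ∃ (λ t → (t ≤ length σ) × (conf σ t ≡ c))

IsHorizontal : Config → Set
IsHorizontal c = ∃ (λ π → Derivation c π)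

-- The configuration obtained from c by keeping only the subsequence u of
-- its prefix (deleting the other entries) and standardising, keeping the
-- slots at the same relative heights; a repeating slot whose value is no
-- longer in the prefix becomes a new slot in the corresponding gap.
restrict : Config → List ℕ → Config
restrict c u = config (std u) repL newL
  where
  m  = maxL (pre c)
  m' = maxL (std u)
  repL = map (λ j → any (λ v → elem v u ∧ (rank u v ≡ᵇ j) ∧ at (rep c) (v ∸ 1)) (range1 m))
             (range1 m')
  newL = map (λ g → any (λ v → not (elem v u) ∧ at (rep c) (v ∸ 1) ∧ (cntBelow u v ≡ᵇ g)) (range1 m)
                   ∨ any (λ g₀ → at (new c) g₀ ∧ (cntBelow u (suc g₀) ≡ᵇ g)) (range0 m))
             (range0 m')

IsSubconfig : Config → Config → Set
IsSubconfig c' c = IsHorizontal c' × ∃ (λ u → (u ⊆ pre c) × (restrict c u ≡ c'))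

-- Let σ derive c at time t, with prefix u and remainder r, and let c' keep the
-- subword w of u.  Then σ' = std (w r) is contained in σ and derives c' at time
-- |w|.  Both configurations only see the relative order of values: ranking the
-- letters of w r among themselves or among u changes no count of smaller
-- values.  A letter of r occurring in w yields the same repeating slot in both;
-- a letter of r not occurring in w sits in the gap of w containing it, whether
-- it was new in c or repeated a deleted prefix value.
module Submission where

open import Defs
open import Data.Bool using (Bool; true; false; _∧_; _∨_; not; T)
open import Data.Bool.Properties using (T-∧; T-∨)
open import Data.Bool.ListAction using (any)
open import Data.Nat using (ℕ; zero; suc; _≤_; _<_; _≤′_; ≤′-refl; ≤′-step; _+_; _∸_; _≡ᵇ_; _≟_; z≤n; s≤s)
open import Data.Nat.Properties
open import Data.List using (List; []; _∷_; [_]; _++_; map; filter; length; take; drop; applyUpTo; upTo)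
open import Data.List.Properties
  using (upTo-∷ʳ; filter-++; length-++; filter-accept; filter-reject; map-∘; map-cong; take-map; drop-map; take++drop≡id; length-map)
open import Data.List.Membership.Propositional using (_∈_; _∉_; find; lose)
open import Data.List.Membership.Propositional.Properties using (∈-map⁺; ∈-map⁻; ∈-applyUpTo⁺; ∈-applyUpTo⁻; ∈-++⁺ˡ; ∈-++⁺ʳ)
open import Data.List.Membership.DecPropositional _≟_ using (_∈?_)
open import Data.List.Relation.Unary.Any using (here; there)
import Data.List.Relation.Unary.Any as Any
open import Data.List.Relation.Unary.Any.Properties using (any⁺; any⁻)
open import Data.List.Relation.Unary.All using (universal)
open import Data.List.Relation.Unary.All.Properties using () renaming (map⁺ to All-map⁺)
open import Data.List.Relation.Binary.Subset.Propositional using () renaming (_⊆_ to _⊆ₛ_)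
open import Data.List.Relation.Binary.Sublist.Propositional using (_⊆_; []; _∷_; _∷ʳ_; lookup; ⊆-refl)
open import Data.List.Relation.Binary.Sublist.Propositional.Properties using (++⁺)
open import Data.Product using (∃; _×_; _,_)
open import Data.Sum using (inj₁; inj₂)
open import Data.Empty using (⊥-elim)
open import Function using (_∘_; id; _⇔_; mk⇔; Equivalence)
import Function.Properties.Equivalence as ⇔
open import Relation.Nullary using (¬_; Dec; yes; no; contradiction)
open import Relation.Nullary.Decidable using (T?)
open import Relation.Binary.Definitions using (tri<; tri≈; tri>)
open import Relation.Binary.PropositionalEquality using (_≡_; refl; sym; trans; cong; cong₂; subst; module ≡-Reasoning)

open Equivalence using (to; from)
open ≡-Reasoning

T-injective : ∀ {a b} → T a ⇔ T b → a ≡ b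
T-injective {false} {false} _   = refl
T-injective {false} {true}  a⇔b = ⊥-elim (from a⇔b _)
T-injective {true}  {false} a⇔b = ⊥-elim (to a⇔b _)
T-injective {true}  {true}  _   = refl

T-not⁻ : ∀ {a} → T (not a) → ¬ T a
T-not⁻ {false} _ ()

T-not⁺ : ∀ {a} → ¬ T a → T (not a)
T-not⁺ {false} _  = _
T-not⁺ {true}  ¬a = ¬a _

any-∈⁻ : ∀ {A : Set} (p : A → Bool) xs → T (any p xs) → ∃ λ x → x ∈ xs × T (p x)
any-∈⁻ p xs = find ∘ any⁻ p xs

any-∈⁺ : ∀ {A : Set} (p : A → Bool) {xs x} → x ∈ xs → T (p x) → T (any p xs)
any-∈⁺ p x∈xs px = any⁺ p (lose x∈xs px)

T-elem⁻ : ∀ {x L} → T (elem x L) → x ∈ L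
T-elem⁻ {x} {L} = Any.map (λ {y} → ≡ᵇ⇒≡ x y) ∘ any⁻ (x ≡ᵇ_) L

T-elem⁺ : ∀ {x L} → x ∈ L → T (elem x L)
T-elem⁺ {x} = any⁺ (x ≡ᵇ_) ∘ Any.map (λ {y} → ≡⇒≡ᵇ x y)

≤maxL : ∀ {x L} → x ∈ L → x ≤ maxL L
≤maxL {L = y ∷ L} (here refl)  = m≤m⊔n y (maxL L)
≤maxL {L = y ∷ L} (there x∈L) = ≤-trans (≤maxL x∈L) (m≤n⊔m y (maxL L))

maxL∈ : ∀ x L → maxL (x ∷ L) ∈ x ∷ L
maxL∈ x []      = here (⊔-identityʳ x)
maxL∈ x (y ∷ L) with ⊔-sel x (maxL (y ∷ L))
... | inj₁ eq = here eq
... | inj₂ eq = there (subst (_∈ y ∷ L) (sym eq) (maxL∈ y L))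

cntBelow-suc : ∀ L y → cntBelow L (suc y) ≡ cntBelow L y + length (filter (λ v → T? (elem v L)) [ y ])
cntBelow-suc L y = begin
  length (filter P? (upTo (suc y)))               ≡⟨ cong (length ∘ filter P?) (sym (upTo-∷ʳ y)) ⟩
  length (filter P? (upTo y ++ [ y ]))            ≡⟨ cong length (filter-++ P? (upTo y) [ y ]) ⟩
  length (filter P? (upTo y) ++ filter P? [ y ])  ≡⟨ length-++ (filter P? (upTo y)) ⟩
  cntBelow L y + length (filter P? [ y ])         ∎
  where
  P? : (v : ℕ) → Dec (T (elem v L))
  P? v = T? (elem v L)

cntBelow-suc-∈ : ∀ {L y} → y ∈ L → cntBelow L (suc y) ≡ suc (cntBelow L y)
cntBelow-suc-∈ {L} {y} y∈L = begin
  cntBelow L (suc y)  ≡⟨ cntBelow-suc L y ⟩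
  cntBelow L y + length (filter (λ v → T? (elem v L)) [ y ])
    ≡⟨ cong (λ ys → cntBelow L y + length ys) (filter-accept (λ v → T? (elem v L)) (T-elem⁺ y∈L)) ⟩
  cntBelow L y + 1    ≡⟨ +-comm (cntBelow L y) 1 ⟩
  suc (cntBelow L y)  ∎

cntBelow-suc-∉ : ∀ {L y} → y ∉ L → cntBelow L (suc y) ≡ cntBelow L y
cntBelow-suc-∉ {L} {y} y∉L = begin
  cntBelow L (suc y)  ≡⟨ cntBelow-suc L y ⟩
  cntBelow L y + length (filter (λ v → T? (elem v L)) [ y ])
    ≡⟨ cong (λ ys → cntBelow L y + length ys) (filter-reject (λ v → T? (elem v L)) (y∉L ∘ T-elem⁻)) ⟩
  cntBelow L y + 0    ≡⟨ +-identityʳ (cntBelow L y) ⟩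
  cntBelow L y        ∎

cntBelow-mono : ∀ L {x y} → x ≤ y → cntBelow L x ≤ cntBelow L y
cntBelow-mono L = mono′ ∘ ≤⇒≤′
  where
  mono′ : ∀ {x y} → x ≤′ y → cntBelow L x ≤ cntBelow L y
  mono′ ≤′-refl           = ≤-refl
  mono′ (≤′-step {n} x≤′n) =
    ≤-trans (mono′ x≤′n) (subst (cntBelow L n ≤_) (sym (cntBelow-suc L n)) (m≤m+n _ _))

cntBelow-< : ∀ {L x y} → x ∈ L → x < y → cntBelow L x < cntBelow L y
cntBelow-< {L} {y = y} x∈L x<y = subst (_≤ cntBelow L y) (cntBelow-suc-∈ x∈L) (cntBelow-mono L x<y)

rank-injective : ∀ {L x y} → x ∈ L → y ∈ L → rank L x ≡ rank L y → x ≡ y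
rank-injective {x = x} {y} x∈L y∈L eq with <-cmp x y
... | tri< x<y _ _ = contradiction (suc-injective eq) (<⇒≢ (cntBelow-< x∈L x<y))
... | tri≈ _ x≡y _ = x≡y
... | tri> _ _ y<x = contradiction (suc-injective (sym eq)) (<⇒≢ (cntBelow-< y∈L y<x))

∈-map-rank⁻ : ∀ {L w y} → w ⊆ₛ L → y ∈ L → rank L y ∈ map (rank L) w → y ∈ w
∈-map-rank⁻ {L} w⊆L y∈L ry∈ with ∈-map⁻ (rank L) ry∈
... | x , x∈w , eq = subst (_∈ _) (sym (rank-injective y∈L (w⊆L x∈w) eq)) x∈w

rank≤maxL : ∀ {L x} → x ∈ L → rank L x ≤ maxL (std L)
rank≤maxL {L} = ≤maxL ∘ ∈-map⁺ (rank L)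

cntBelow≤maxL : ∀ L y → cntBelow L y ≤ maxL (std L)
cntBelow≤maxL L zero = z≤n
cntBelow≤maxL L (suc y) with y ∈? L
... | yes y∈L = subst (_≤ maxL (std L)) (sym (cntBelow-suc-∈ y∈L)) (rank≤maxL y∈L)
... | no y∉L  = subst (_≤ maxL (std L)) (sym (cntBelow-suc-∉ y∉L)) (cntBelow≤maxL L y)

cntBelow-intermediate : ∀ L {j} y → j < cntBelow L y → ∃ λ x → x ∈ L × cntBelow L x ≡ j
cntBelow-intermediate L (suc y) j< with y ∈? L
... | no y∉L = cntBelow-intermediate L y (subst (_ <_) (cntBelow-suc-∉ y∉L) j<)
... | yes y∈L with m<1+n⇒m<n∨m≡n (subst (_ <_) (cntBelow-suc-∈ y∈L) j<)
...   | inj₁ j<cnt = cntBelow-intermediate L y j<cnt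
...   | inj₂ refl  = y , y∈L , refl

std-isCayley : ∀ τ → IsCayley (std τ)
std-isCayley τ = All-map⁺ (universal (λ _ → s≤s z≤n) τ) , onto τ
  where
  -- The largest rank is rank v x* = cntBelow v (suc x*); every smaller count is attained.
  onto : ∀ v k → 1 ≤ k → k ≤ maxL (std v) → k ∈ std v
  onto []          (suc j) _ ()
  onto v@(x ∷ xs) (suc j) _ k≤max with ∈-map⁻ (rank v) (maxL∈ (rank v x) (map (rank v) xs))
  ... | x* , x*∈v , max≡ with cntBelow-intermediate v (suc x*)
        (subst (j <_) (sym (cntBelow-suc-∈ x*∈v)) (subst (suc j ≤_) max≡ k≤max))
  ... | z , z∈v , refl = ∈-map⁺ (rank v) z∈v

module _ {L w : List ℕ} (w⊆L : w ⊆ₛ L) where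

  private
    w′ : List ℕ
    w′ = map (rank L) w

  -- Induction on y: rank L y occurs in w′ exactly when y occurs in w.
  cntBelow-map-rank : ∀ y → cntBelow w′ (rank L y) ≡ cntBelow w y
  cntBelow-map-rank zero = cntBelow-suc-∉ 0∉w′
    where
    0∉w′ : 0 ∉ w′
    0∉w′ 0∈ with ∈-map⁻ (rank L) 0∈
    ... | _ , _ , ()
  cntBelow-map-rank (suc y) with y ∈? L
  ... | no y∉L = begin
    cntBelow w′ (rank L (suc y))  ≡⟨ cong (cntBelow w′ ∘ suc) (cntBelow-suc-∉ y∉L) ⟩
    cntBelow w′ (rank L y)        ≡⟨ cntBelow-map-rank y ⟩
    cntBelow w y                  ≡⟨ sym (cntBelow-suc-∉ (y∉L ∘ w⊆L)) ⟩
    cntBelow w (suc y)            ∎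
  ... | yes y∈L with y ∈? w
  ...   | yes y∈w = begin
    cntBelow w′ (rank L (suc y))  ≡⟨ cong (cntBelow w′ ∘ suc) (cntBelow-suc-∈ y∈L) ⟩
    cntBelow w′ (suc (rank L y))  ≡⟨ cntBelow-suc-∈ (∈-map⁺ (rank L) y∈w) ⟩
    suc (cntBelow w′ (rank L y))  ≡⟨ cong suc (cntBelow-map-rank y) ⟩
    suc (cntBelow w y)            ≡⟨ sym (cntBelow-suc-∈ y∈w) ⟩
    cntBelow w (suc y)            ∎
  ...   | no y∉w = begin
    cntBelow w′ (rank L (suc y))  ≡⟨ cong (cntBelow w′ ∘ suc) (cntBelow-suc-∈ y∈L) ⟩
    cntBelow w′ (suc (rank L y))  ≡⟨ cntBelow-suc-∉ (y∉w ∘ ∈-map-rank⁻ w⊆L y∈L) ⟩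
    cntBelow w′ (rank L y)        ≡⟨ cntBelow-map-rank y ⟩
    cntBelow w y                  ≡⟨ sym (cntBelow-suc-∉ y∉w) ⟩
    cntBelow w (suc y)            ∎

  rank-map-rank : ∀ y → rank w′ (rank L y) ≡ rank w y
  rank-map-rank = cong suc ∘ cntBelow-map-rank

  std-map-rank : std w′ ≡ std w
  std-map-rank = begin
    map (rank w′) (map (rank L) w)  ≡⟨ sym (map-∘ w) ⟩
    map (rank w′ ∘ rank L) w        ≡⟨ map-cong rank-map-rank w ⟩
    map (rank w) w                  ∎

repBit : List ℕ → List ℕ → ℕ → Bool
repBit u r j = any (λ x → (rank u x ≡ᵇ j) ∧ elem x r) u

newBit : List ℕ → List ℕ → ℕ → Bool
newBit u r g = any (λ y → not (elem y u) ∧ (cntBelow u y ≡ᵇ g)) r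

-- conf π t unfolds to confOf (take t π) (drop t π).
confOf : List ℕ → List ℕ → Config
confOf u r = config (std u) (map (repBit u r) (range1 (maxL (std u)))) (map (newBit u r) (range0 (maxL (std u))))

RepeatingSlot : List ℕ → List ℕ → ℕ → Set
RepeatingSlot u r j = ∃ λ x → x ∈ u × x ∈ r × rank u x ≡ j

-- Gap g of u is the one lying above exactly g distinct values of u.
NewSlot : List ℕ → List ℕ → ℕ → Set
NewSlot u r g = ∃ λ y → y ∈ r × y ∉ u × cntBelow u y ≡ g

T-repBit⇔ : ∀ u r j → T (repBit u r j) ⇔ RepeatingSlot u r j
T-repBit⇔ u r j = mk⇔ sound complete
  where
  sound : T (repBit u r j) → RepeatingSlot u r j
  sound bit with any-∈⁻ _ u bit
  ... | x , x∈u , p with to T-∧ p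
  ...   | eq , x∈r = x , x∈u , T-elem⁻ x∈r , ≡ᵇ⇒≡ _ _ eq
  complete : RepeatingSlot u r j → T (repBit u r j)
  complete (x , x∈u , x∈r , refl) = any-∈⁺ _ x∈u (from T-∧ (≡⇒≡ᵇ (rank u x) _ refl , T-elem⁺ x∈r))

T-newBit⇔ : ∀ u r g → T (newBit u r g) ⇔ NewSlot u r g
T-newBit⇔ u r g = mk⇔ sound complete
  where
  sound : T (newBit u r g) → NewSlot u r g
  sound bit with any-∈⁻ _ r bit
  ... | y , y∈r , p with to T-∧ p
  ...   | y∉ , eq = y , y∈r , T-not⁻ y∉ ∘ T-elem⁺ , ≡ᵇ⇒≡ _ _ eq
  complete : NewSlot u r g → T (newBit u r g)
  complete (y , y∈r , y∉u , refl) = any-∈⁺ _ y∈r (from T-∧ (T-not⁺ (y∉u ∘ T-elem⁻) , ≡⇒≡ᵇ (cntBelow u y) _ refl))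

config-≡ : ∀ {p p′ rs rs′ ns ns′} → p ≡ p′ → rs ≡ rs′ → ns ≡ ns′ → config p rs ns ≡ config p′ rs′ ns′
config-≡ refl refl refl = refl

map-T-cong : ∀ {p q : ℕ → Bool} {P : ℕ → Set} (f : ℕ → List ℕ) {m n} → m ≡ n →
             (∀ i → T (p i) ⇔ P i) → (∀ i → T (q i) ⇔ P i) → map p (f m) ≡ map q (f n)
map-T-cong f refl p⇔P q⇔P = map-cong (λ i → T-injective (⇔.trans (p⇔P i) (⇔.sym (q⇔P i)))) (f _)

confOf-cong : ∀ {u r u′ r′} → std u ≡ std u′ →
              (∀ j → RepeatingSlot u r j ⇔ RepeatingSlot u′ r′ j) → (∀ g → NewSlot u r g ⇔ NewSlot u′ r′ g) →
              confOf u r ≡ confOf u′ r′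
confOf-cong {u} {r} {u′} {r′} std≡ rep⇔ new⇔ = config-≡ std≡
  (map-T-cong range1 (cong maxL std≡) (λ j → ⇔.trans (T-repBit⇔ u r j) (rep⇔ j)) (T-repBit⇔ u′ r′))
  (map-T-cong range0 (cong maxL std≡) (λ g → ⇔.trans (T-newBit⇔ u r g) (new⇔ g)) (T-newBit⇔ u′ r′))

confOf-map-rank : ∀ {τ w r} → w ⊆ₛ τ → r ⊆ₛ τ → confOf (map (rank τ) w) (map (rank τ) r) ≡ confOf w r
confOf-map-rank {τ} {w} {r} w⊆τ r⊆τ = confOf-cong (std-map-rank w⊆τ) (λ j → mk⇔ rep⇒ rep⇐) (λ g → mk⇔ new⇒ new⇐)
  where
  rep⇒ : ∀ {j} → RepeatingSlot (map (rank τ) w) (map (rank τ) r) j → RepeatingSlot w r j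
  rep⇒ (x′ , x′∈ , x′∈r′ , eq) with ∈-map⁻ (rank τ) x′∈
  ... | x , x∈w , refl = x , x∈w , ∈-map-rank⁻ r⊆τ (w⊆τ x∈w) x′∈r′ , trans (sym (rank-map-rank w⊆τ x)) eq
  rep⇐ : ∀ {j} → RepeatingSlot w r j → RepeatingSlot (map (rank τ) w) (map (rank τ) r) j
  rep⇐ (x , x∈w , x∈r , refl) = rank τ x , ∈-map⁺ (rank τ) x∈w , ∈-map⁺ (rank τ) x∈r , rank-map-rank w⊆τ x
  new⇒ : ∀ {g} → NewSlot (map (rank τ) w) (map (rank τ) r) g → NewSlot w r g
  new⇒ (y′ , y′∈ , y′∉ , eq) with ∈-map⁻ (rank τ) y′∈
  ... | y , y∈r , refl = y , y∈r , y′∉ ∘ ∈-map⁺ (rank τ) , trans (sym (cntBelow-map-rank w⊆τ y)) eq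
  new⇐ : ∀ {g} → NewSlot w r g → NewSlot (map (rank τ) w) (map (rank τ) r) g
  new⇐ (y , y∈r , y∉w , refl) =
    rank τ y , ∈-map⁺ (rank τ) y∈r , y∉w ∘ ∈-map-rank⁻ w⊆τ (r⊆τ y∈r) , cntBelow-map-rank w⊆τ y

at-map-applyUpTo : ∀ (p : ℕ → Bool) f {n i} → i < n → at (map p (applyUpTo f n)) i ≡ p (f i)
at-map-applyUpTo p f {suc n} {zero}  _         = refl
at-map-applyUpTo p f {suc n} {suc i} (s≤s i<n) = at-map-applyUpTo p (f ∘ suc) i<n

module Restriction {u r w : List ℕ} (w⊆u : w ⊆ₛ u) where

  private
    u′ : List ℕ
    u′ = map (rank u) w

    m : ℕ
    m = maxL (std u)

  -- The bits of restrict (confOf u r) u′, spelt out as in Defs: a slot of the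
  -- restriction comes from a repeating slot at a kept value, from a repeating
  -- slot at a deleted value, or from a new slot.
  repeatsKept : ℕ → ℕ → Bool
  repeatsKept j v = elem v u′ ∧ (rank u′ v ≡ᵇ j) ∧ at (rep (confOf u r)) (v ∸ 1)

  repeatsDeleted : ℕ → ℕ → Bool
  repeatsDeleted g v = not (elem v u′) ∧ at (rep (confOf u r)) (v ∸ 1) ∧ (cntBelow u′ v ≡ᵇ g)

  wasNew : ℕ → ℕ → Bool
  wasNew g g₀ = at (new (confOf u r)) g₀ ∧ (cntBelow u′ (suc g₀) ≡ᵇ g)

  restrictRepBit : ℕ → Bool
  restrictRepBit j = any (repeatsKept j) (range1 m)

  restrictNewBit : ℕ → Bool
  restrictNewBit g = any (repeatsDeleted g) (range1 m) ∨ any (wasNew g) (range0 m)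

  T-repAt⇔ : ∀ {v} → v ∈ range1 m → T (at (rep (confOf u r)) (v ∸ 1)) ⇔ RepeatingSlot u r v
  T-repAt⇔ v∈ with ∈-applyUpTo⁻ suc v∈
  ... | i , i<m , refl rewrite at-map-applyUpTo (repBit u r) suc i<m = T-repBit⇔ u r (suc i)

  T-newAt⇔ : ∀ {g} → g ∈ range0 m → T (at (new (confOf u r)) g) ⇔ NewSlot u r g
  T-newAt⇔ g∈ with ∈-applyUpTo⁻ id g∈
  ... | i , i<m , refl rewrite at-map-applyUpTo (newBit u r) id i<m = T-newBit⇔ u r i

  rank∈range1 : ∀ {x} → x ∈ u → rank u x ∈ range1 m
  rank∈range1 = ∈-applyUpTo⁺ suc ∘ rank≤maxL

  cntBelow∈range0 : ∀ y → cntBelow u y ∈ range0 m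
  cntBelow∈range0 y = ∈-applyUpTo⁺ id (s≤s (cntBelow≤maxL u y))

  T-restrictRepBit⇔ : ∀ j → T (restrictRepBit j) ⇔ RepeatingSlot w r j
  T-restrictRepBit⇔ j = mk⇔ sound complete
    where
    sound : T (restrictRepBit j) → RepeatingSlot w r j
    sound bit with any-∈⁻ (repeatsKept j) (range1 m) bit
    ... | v , v∈ , p with to (T-∧ {elem v u′}) p
    ...   | v∈u′ , q with to (T-∧ {rank u′ v ≡ᵇ j}) q | ∈-map⁻ (rank u) (T-elem⁻ {v} {u′} v∈u′)
    ...     | eq , atv | x , x∈w , refl with to (T-repAt⇔ v∈) atv
    ...       | x′ , x′∈u , x′∈r , rx′≡rx =
      x , x∈w , subst (_∈ r) (rank-injective x′∈u (w⊆u x∈w) rx′≡rx) x′∈r ,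
      trans (sym (rank-map-rank w⊆u x)) (≡ᵇ⇒≡ (rank u′ (rank u x)) j eq)
    complete : RepeatingSlot w r j → T (restrictRepBit j)
    complete (x , x∈w , x∈r , refl) = any-∈⁺ (repeatsKept j) (rank∈range1 x∈u)
      (from T-∧ (T-elem⁺ (∈-map⁺ (rank u) x∈w) ,
       from T-∧ (≡⇒≡ᵇ _ _ (rank-map-rank w⊆u x) , from (T-repAt⇔ (rank∈range1 x∈u)) (x , x∈u , x∈r , refl))))
      where
      x∈u : x ∈ u
      x∈u = w⊆u x∈w

  T-restrictNewBit⇔ : ∀ g → T (restrictNewBit g) ⇔ NewSlot w r g
  T-restrictNewBit⇔ g = mk⇔ sound complete
    where
    sound : T (restrictNewBit g) → NewSlot w r g
    sound bit with to T-∨ bit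
    ... | inj₁ bit₁ with any-∈⁻ (repeatsDeleted g) (range1 m) bit₁
    ...   | v , v∈ , p with to (T-∧ {not (elem v u′)}) p
    ...     | v∉u′ , q with to (T-∧ {at (rep (confOf u r)) (v ∸ 1)}) q
    ...       | atv , eq with to (T-repAt⇔ v∈) atv
    ...         | x , x∈u , x∈r , refl =
      x , x∈r , T-not⁻ v∉u′ ∘ T-elem⁺ ∘ ∈-map⁺ (rank u) , trans (sym (cntBelow-map-rank w⊆u x)) (≡ᵇ⇒≡ (cntBelow u′ (rank u x)) g eq)
    sound bit | inj₂ bit₂ with any-∈⁻ (wasNew g) (range0 m) bit₂
    ...   | g₀ , g₀∈ , p with to (T-∧ {at (new (confOf u r)) g₀}) p
    ...     | atg₀ , eq with to (T-newAt⇔ g₀∈) atg₀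
    ...       | y , y∈r , y∉u , refl = y , y∈r , y∉u ∘ w⊆u , trans (sym (cntBelow-map-rank w⊆u y)) (≡ᵇ⇒≡ (cntBelow u′ (rank u y)) g eq)
    complete : NewSlot w r g → T (restrictNewBit g)
    complete (y , y∈r , y∉w , refl) with y ∈? u
    ... | yes y∈u = from T-∨ (inj₁ (any-∈⁺ (repeatsDeleted g) (rank∈range1 y∈u)
      (from T-∧ (T-not⁺ (y∉w ∘ ∈-map-rank⁻ w⊆u y∈u ∘ T-elem⁻ {L = u′}) ,
       from T-∧ (from (T-repAt⇔ (rank∈range1 y∈u)) (y , y∈u , y∈r , refl) , ≡⇒≡ᵇ _ _ (cntBelow-map-rank w⊆u y))))))
    ... | no y∉u = from (T-∨ {any (repeatsDeleted g) (range1 m)}) (inj₂ (any-∈⁺ (wasNew g) (cntBelow∈range0 y)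
      (from T-∧ (from (T-newAt⇔ (cntBelow∈range0 y)) (y , y∈r , y∉u , refl) , ≡⇒≡ᵇ _ _ (cntBelow-map-rank w⊆u y)))))

  restrict-confOf : restrict (confOf u r) (map (rank u) w) ≡ confOf w r
  restrict-confOf = config-≡ std≡
    (map-T-cong range1 (cong maxL std≡) T-restrictRepBit⇔ (T-repBit⇔ w r))
    (map-T-cong range0 (cong maxL std≡) T-restrictNewBit⇔ (T-newBit⇔ w r))
    where
    std≡ : std (map (rank u) w) ≡ std w
    std≡ = std-map-rank w⊆u

open Restriction using (restrict-confOf)

⊆-map⁻ : ∀ (g : ℕ → ℕ) L {K} → K ⊆ map g L → ∃ λ w → w ⊆ L × map g w ≡ K
⊆-map⁻ g []      []       = [] , [] , refl
⊆-map⁻ g (x ∷ L) (_ ∷ʳ K⊆) with ⊆-map⁻ g L K⊆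
... | w , w⊆L , refl = w , x ∷ʳ w⊆L , refl
⊆-map⁻ g (x ∷ L) (refl ∷ K⊆) with ⊆-map⁻ g L K⊆
... | w , w⊆L , refl = x ∷ w , refl ∷ w⊆L , refl

take-length-++ : ∀ {A : Set} (xs ys : List A) → take (length xs) (xs ++ ys) ≡ xs
take-length-++ []       ys = refl
take-length-++ (x ∷ xs) ys = cong (x ∷_) (take-length-++ xs ys)

drop-length-++ : ∀ {A : Set} (xs ys : List A) → drop (length xs) (xs ++ ys) ≡ ys
drop-length-++ []       ys = refl
drop-length-++ (x ∷ xs) ys = drop-length-++ xs ys

lemma5p1 : (c c' : Config) → IsHorizontal c → IsSubconfig c' c →
    (σ : List ℕ) → Derivation c σ →
    ∃ (λ σ' → Derivation c' σ' × Contains σ σ')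
lemma5p1 c c' _ (_ , _ , u′⊆std , refl) σ (_ , t , _ , refl) with ⊆-map⁻ (rank (take t σ)) (take t σ) u′⊆std
... | w , w⊆u , refl = std τ , (std-isCayley τ , length w , |w|≤ , conf≡) , τ , τ⊆σ , refl
  where
  r : List ℕ
  r = drop t σ

  τ : List ℕ
  τ = w ++ r

  |w|≤ : length w ≤ length (std τ)
  |w|≤ = subst (length w ≤_) (sym (trans (length-map (rank τ) τ) (length-++ w))) (m≤m+n _ _)

  τ⊆σ : τ ⊆ σ
  τ⊆σ = subst (τ ⊆_) (take++drop≡id t σ) (++⁺ w⊆u ⊆-refl)

  conf≡ : conf (std τ) (length w) ≡ restrict (conf σ t) (map (rank (take t σ)) w)
  conf≡ = begin
    conf (std τ) (length w)
      ≡⟨ cong₂ confOf (trans (take-map (length w) τ) (cong (map (rank τ)) (take-length-++ w r)))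
                      (trans (drop-map (length w) τ) (cong (map (rank τ)) (drop-length-++ w r))) ⟩
    confOf (map (rank τ) w) (map (rank τ) r)  ≡⟨ confOf-map-rank ∈-++⁺ˡ (∈-++⁺ʳ w) ⟩
    confOf w r                                 ≡⟨ sym (restrict-confOf {r = r} (lookup w⊆u)) ⟩
    restrict (conf σ t) (map (rank (take t σ)) w) ∎
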